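{- Let $\ell\in\{1,2\}$ and let $G$ be a $(2,\ell)$-tight simple graph with the property that every edge lying in a copy of $K_3$ in $G$ lies in at least two copies of $K_3$ in $G$. Then every copy of $K_3$ in $G$ is contained in a copy of $K_4$ in $G$.
   Context: For a graph $H$ let $f(H)=2|V(H)|-|E(H)|$. A simple graph $G$ is $(2,\ell)$-sparse if $f(H)\ge \ell$ for every subgraph $H$ of $G$ with at least one edge, and $(2,\ell)$-tight if it is $(2,\ell)$-sparse and $f(G)=\ell$. -}

module Defs where

open import Data.Nat using (ℕ; zero; suc; _+_; _*_; _<_; _≤_)
open import Data.Nat.Properties using (_<?_)
open import Data.Bool using (Bool; true; false; _∧_; if_then_else_)
open import Data.Fin using (Fin; toℕ)
open import Data.List using (map; allFin)
open import Data.Nat.ListAction using (sum)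
open import Data.Product using (_×_; Σ; ∃; ∃-syntax)
open import Relation.Nullary.Decidable using (⌊_⌋)
open import Relation.Binary.PropositionalEquality using (_≡_)

record Graph (n : ℕ) : Set where
  field
    adj    : Fin n → Fin n → Bool
    sym    : ∀ i j → adj i j ≡ adj j i
    irrefl : ∀ i → adj i i ≡ false

open Graph public

count : ∀ {n} → (Fin n → Bool) → ℕ
count {n} P = sum (map (λ i → if P i then 1 else 0) (allFin n))

edgeCount : ∀ {n} → (Fin n → Fin n → Bool) → ℕ
edgeCount {n} R = sum (map (λ i → count (λ j → ⌊ toℕ i <? toℕ j ⌋ ∧ R i j)) (allFin n))

record Subgraph {n : ℕ} (G : Graph n) : Set where
  field
    vs    : Fin n → Bool
    es    : Fin n → Fin n → Bool
    es-sym : ∀ i j → es i j ≡ es j i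
    es-sub : ∀ i j → es i j ≡ true → adj G i j ≡ true
    es-vs  : ∀ i j → es i j ≡ true → (vs i ≡ true) × (vs j ≡ true)

open Subgraph public

nV : ∀ {n} {G : Graph n} → Subgraph G → ℕ
nV H = count (vs H)

nE : ∀ {n} {G : Graph n} → Subgraph G → ℕ
nE H = edgeCount (es H)

-- f(H) ≥ ℓ, i.e. 2|V(H)| - |E(H)| ≥ ℓ (stated without subtraction)
fAtLeast : ℕ → ℕ → ℕ → Set
fAtLeast ℓ v e = ℓ + e ≤ 2 * v

Sparse : ∀ {n} → ℕ → Graph n → Set
Sparse ℓ G = ∀ (H : Subgraph G) → (∃[ i ] ∃[ j ] es H i j ≡ true) → fAtLeast ℓ (nV H) (nE H)

Tight : ∀ {n} → ℕ → Graph n → Set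
Tight {n} ℓ G = Sparse ℓ G × (ℓ + edgeCount (adj G) ≡ 2 * count {n} (λ _ → true))

E : ∀ {n} → Graph n → Fin n → Fin n → Set
E G i j = adj G i j ≡ true

-- u, v, w span a copy of K3 (distinctness follows from irreflexivity)
Triangle : ∀ {n} → Graph n → Fin n → Fin n → Fin n → Set
Triangle G u v w = E G u v × E G v w × E G u w

module Submission where

-- Only (2, 1)-sparsity is used: f(H) = 2|V(H)| - |E(H)| ≥ 1 for subgraphs H
-- with an edge.  Suppose the triangle uvw has no common neighbour.  Its
-- second triangles uvx, uwy, vwz span a subgraph H with f(H) = 3 in which
-- x, y, z are "tips": their second triangles are still missing.  We grow H
-- by closing missing triangles of G.  Attaching a new vertex to an edge keeps
-- f; adding an edge between old vertices lowers f by one and is recorded in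
-- a list X of surplus edges.  The invariant (record 'Invariant') is
-- f(H) ≤ 3 - |X| together with three pairwise separated slots, each a tip or
-- a spent surplus edge ('EdgeStep', 'AttachStep').  Sparsity bounds |E(H)|,
-- so the process ends in a closed H, where |X| ≤ 2 but the three slots need
-- three surplus edges ('Terminal'): a contradiction.

open import Defs hiding (sym)
open import Data.Nat using (ℕ; zero; suc; _+_; _*_; _<_; _≤_; z≤n; s≤s)
open import Data.Nat.Properties
  using (_<?_; +-suc; +-identityʳ; +-mono-≤; +-monoˡ-≤; +-cancelˡ-≤; *-monoʳ-≤; ≤-refl; ≤-trans; ≤-pred;
         ≤-reflexive; n≤1+n; m≤n+m; <⇒≢; <⇒≱; <-asym; <-cmp)
open import Data.Bool using (Bool; true; false; _∧_; _∨_; if_then_else_)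
open import Data.Bool.Properties using (∨-zeroʳ; ∨-identityʳ; ∧-zeroʳ) renaming (_≟_ to _≟ᵇ_)
open import Data.Fin using (Fin; toℕ; zero; suc)
open import Data.Fin.Properties using (_≟_; toℕ-injective; suc-injective; any?)
open import Data.List using (List; []; _∷_; length; map; allFin; tabulate)
open import Data.List.Membership.Propositional using (_∈_)
open import Data.List.Relation.Unary.Any using (here; there)
open import Data.List.Relation.Unary.All using (All; []; _∷_)
open import Data.List.Relation.Unary.All.Properties using (All¬⇒¬Any)
open import Data.List.Properties using (map-tabulate)
open import Data.Nat.ListAction using (sum)
open import Data.Product using (_×_; _,_; proj₁; proj₂; Σ; ∃-syntax)
open import Data.Sum using (_⊎_; inj₁; inj₂; [_,_]′)
open import Data.Empty using (⊥; ⊥-elim)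
open import Data.Unit using (⊤; tt)
open import Relation.Nullary using (¬_; Dec; yes; no)
open import Relation.Nullary.Decidable using (⌊_⌋; _×-dec_; _⊎-dec_)
open import Relation.Binary.Definitions using (tri<; tri≈; tri>)
open import Relation.Binary.PropositionalEquality
  using (_≡_; refl; sym; trans; cong; cong₂; subst; subst₂; module ≡-Reasoning)
open import Function using (_∘_; id)

⌊⌋-true : ∀ {P : Set} (d : Dec P) → P → ⌊ d ⌋ ≡ true
⌊⌋-true (yes _) _ = refl
⌊⌋-true (no ¬p) p = ⊥-elim (¬p p)

⌊⌋-false : ∀ {P : Set} (d : Dec P) → ¬ P → ⌊ d ⌋ ≡ false
⌊⌋-false (yes p) ¬p = ⊥-elim (¬p p)
⌊⌋-false (no _) _ = refl

⌊⌋-sound : ∀ {P : Set} (d : Dec P) → ⌊ d ⌋ ≡ true → P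
⌊⌋-sound (yes p) _ = p
⌊⌋-sound (no _) ()

∨-true : ∀ {a b} → a ∨ b ≡ true → a ≡ true ⊎ b ≡ true
∨-true {true} _ = inj₁ refl
∨-true {false} e = inj₂ e

∨-trueˡ : ∀ {a} b → a ≡ true → a ∨ b ≡ true
∨-trueˡ b refl = refl

∨-trueʳ : ∀ a {b} → b ≡ true → a ∨ b ≡ true
∨-trueʳ a refl = ∨-zeroʳ a

not-true : ∀ {b} → ¬ b ≡ true → b ≡ false
not-true {false} _ = refl
not-true {true} h = ⊥-elim (h refl)

false≢true : ¬ false ≡ true
false≢true ()

-- Sums of natural numbers over Fin n.  The counting functions of Defs are
-- sums over 'allFin n'; 'sumFin' is the same sum by recursion on n, which
-- is the form that induction works with.

sumFin : ∀ {n} → (Fin n → ℕ) → ℕ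
sumFin {zero} f = 0
sumFin {suc n} f = f zero + sumFin (f ∘ suc)

sum-allFin : ∀ {n} (f : Fin n → ℕ) → sum (map f (allFin n)) ≡ sumFin f
sum-allFin {n} f = trans (cong sum (map-tabulate id f)) (sum-tabulate f)
  where
  sum-tabulate : ∀ {m} (g : Fin m → ℕ) → sum (tabulate g) ≡ sumFin g
  sum-tabulate {zero} g = refl
  sum-tabulate {suc m} g = cong (g zero +_) (sum-tabulate (g ∘ suc))

sumFin-cong : ∀ {n} {f g : Fin n → ℕ} → (∀ i → f i ≡ g i) → sumFin f ≡ sumFin g
sumFin-cong {zero} h = refl
sumFin-cong {suc n} h = cong₂ _+_ (h zero) (sumFin-cong (h ∘ suc))

sumFin-zero : ∀ {n} → sumFin {n} (λ _ → 0) ≡ 0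
sumFin-zero {zero} = refl
sumFin-zero {suc n} = sumFin-zero {n}

sumFin-≤ : ∀ {n} (f : Fin n → ℕ) → (∀ i → f i ≤ 1) → sumFin f ≤ n
sumFin-≤ {zero} f h = z≤n
sumFin-≤ {suc n} f h = +-mono-≤ (h zero) (sumFin-≤ (f ∘ suc) (h ∘ suc))

sumFin-bump : ∀ {n} {f g : Fin n → ℕ} (k : Fin n) → g k ≡ suc (f k) →
              (∀ i → ¬ i ≡ k → g i ≡ f i) → sumFin g ≡ suc (sumFin f)
sumFin-bump zero hk ho = cong₂ _+_ hk (sumFin-cong (λ i → ho (suc i) (λ ())))
sumFin-bump {f = f} (suc k) hk ho =
  trans (cong₂ _+_ (ho zero (λ ())) (sumFin-bump k hk (λ i i≢k → ho (suc i) (i≢k ∘ suc-injective))))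
        (+-suc (f zero) (sumFin (f ∘ suc)))

indicator : Bool → ℕ
indicator b = if b then 1 else 0

count-sumFin : ∀ {n} (P : Fin n → Bool) → count P ≡ sumFin (indicator ∘ P)
count-sumFin P = sum-allFin (indicator ∘ P)

count-cong : ∀ {n} {P Q : Fin n → Bool} → (∀ i → P i ≡ Q i) → count P ≡ count Q
count-cong {P = P} {Q} h =
  trans (count-sumFin P) (trans (sumFin-cong (cong indicator ∘ h)) (sym (count-sumFin Q)))

count-≤ : ∀ {n} (P : Fin n → Bool) → count P ≤ n
count-≤ P = subst (_≤ _) (sym (count-sumFin P)) (sumFin-≤ _ (indicator-≤ ∘ P))
  where
  indicator-≤ : ∀ b → indicator b ≤ 1
  indicator-≤ true = ≤-refl
  indicator-≤ false = z≤n

count-none : ∀ {n} → count {n} (λ _ → false) ≡ 0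
count-none {n} = trans (count-sumFin {n} (λ _ → false)) (sumFin-zero {n})

count-insert : ∀ {n} {P Q : Fin n → Bool} (k : Fin n) → P k ≡ false → Q k ≡ true →
               (∀ i → ¬ i ≡ k → Q i ≡ P i) → count Q ≡ suc (count P)
count-insert {P = P} {Q} k pk qk ho = begin
  count Q                     ≡⟨ count-sumFin Q ⟩
  sumFin (indicator ∘ Q)      ≡⟨ sumFin-bump k bump (λ i i≢k → cong indicator (ho i i≢k)) ⟩
  suc (sumFin (indicator ∘ P)) ≡⟨ cong suc (sym (count-sumFin P)) ⟩
  suc (count P)               ∎
  where
  open ≡-Reasoning
  bump : indicator (Q k) ≡ suc (indicator (P k))
  bump = trans (cong indicator qk) (cong (suc ∘ indicator) (sym pk))

SamePair : ∀ {n} → Fin n → Fin n → Fin n → Fin n → Set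
SamePair i j x y = (i ≡ x × j ≡ y) ⊎ (i ≡ y × j ≡ x)

samePair? : ∀ {n} (i j x y : Fin n) → Dec (SamePair i j x y)
samePair? i j x y = ((i ≟ x) ×-dec (j ≟ y)) ⊎-dec ((i ≟ y) ×-dec (j ≟ x))

samePair-refl : ∀ {n} {x y : Fin n} → SamePair x y x y
samePair-refl = inj₁ (refl , refl)

samePair-swap : ∀ {n} {i j x y : Fin n} → SamePair i j x y → SamePair j i x y
samePair-swap (inj₁ (i≡x , j≡y)) = inj₂ (j≡y , i≡x)
samePair-swap (inj₂ (i≡y , j≡x)) = inj₁ (j≡x , i≡y)

samePair-sym : ∀ {n} {i j x y : Fin n} → SamePair i j x y → SamePair x y i j
samePair-sym (inj₁ (refl , refl)) = inj₁ (refl , refl)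
samePair-sym (inj₂ (refl , refl)) = inj₂ (refl , refl)

samePair-trans : ∀ {n} {i j x y s t : Fin n} → SamePair i j x y → SamePair x y s t → SamePair i j s t
samePair-trans (inj₁ (refl , refl)) q = q
samePair-trans (inj₂ (refl , refl)) q = samePair-swap q

samePair-first : ∀ {n} {i j x y : Fin n} → SamePair i j x y → x ≡ i ⊎ x ≡ j
samePair-first (inj₁ (refl , _)) = inj₁ refl
samePair-first (inj₂ (_ , refl)) = inj₂ refl

samePair-second : ∀ {n} {i j x y : Fin n} → SamePair i j x y → y ≡ i ⊎ y ≡ j
samePair-second (inj₁ (_ , refl)) = inj₂ refl
samePair-second (inj₂ (refl , _)) = inj₁ refl

pairInd : ∀ {n} → Fin n → Fin n → Fin n → Fin n → Bool
pairInd x y i j = ⌊ samePair? i j x y ⌋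

pairInd-sym : ∀ {n} (x y i j : Fin n) → pairInd x y i j ≡ pairInd x y j i
pairInd-sym x y i j with samePair? i j x y | samePair? j i x y
... | yes _ | yes _ = refl
... | no _ | no _ = refl
... | yes s | no ¬s = ⊥-elim (¬s (samePair-swap s))
... | no ¬s | yes s = ⊥-elim (¬s (samePair-swap s))

-- Adding the single pair {a , b} (a < b) to a relation adds one
-- to row a and leaves every other row unchanged.

edgeRow : ∀ {n} → (Fin n → Fin n → Bool) → Fin n → ℕ
edgeRow R i = count (λ j → ⌊ toℕ i <? toℕ j ⌋ ∧ R i j)

edgeCount-sumFin : ∀ {n} (R : Fin n → Fin n → Bool) → edgeCount R ≡ sumFin (edgeRow R)
edgeCount-sumFin R = sum-allFin (edgeRow R)

edgeCount-none : ∀ {n} → edgeCount {n} (λ _ _ → false) ≡ 0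
edgeCount-none {n} = begin
  edgeCount {n} (λ _ _ → false)        ≡⟨ edgeCount-sumFin {n} (λ _ _ → false) ⟩
  sumFin (edgeRow {n} (λ _ _ → false)) ≡⟨ sumFin-cong {n} emptyRow ⟩
  sumFin {n} (λ _ → 0)                 ≡⟨ sumFin-zero {n} ⟩
  0                                    ∎
  where
  open ≡-Reasoning
  emptyRow : ∀ i → edgeRow {n} (λ _ _ → false) i ≡ 0
  emptyRow i = trans (count-cong {n} (λ j → ∧-zeroʳ _)) (count-none {n})

edgeCount-insert : ∀ {n} {R R′ : Fin n → Fin n → Bool} (a b : Fin n) → toℕ a < toℕ b →
  R a b ≡ false → R′ a b ≡ true → (∀ i j → ¬ SamePair i j a b → R′ i j ≡ R i j) →
  edgeCount R′ ≡ suc (edgeCount R)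
edgeCount-insert {R = R} {R′} a b a<b Rab R′ab others = begin
  edgeCount R′             ≡⟨ edgeCount-sumFin R′ ⟩
  sumFin (edgeRow R′)      ≡⟨ sumFin-bump a rowA otherRows ⟩
  suc (sumFin (edgeRow R)) ≡⟨ cong suc (sym (edgeCount-sumFin R)) ⟩
  suc (edgeCount R)        ∎
  where
  open ≡-Reasoning
  a<?b : ⌊ toℕ a <? toℕ b ⌋ ≡ true
  a<?b = ⌊⌋-true (toℕ a <? toℕ b) a<b
  a≢b : ¬ a ≡ b
  a≢b a≡b = <⇒≢ a<b (cong toℕ a≡b)
  rowA : edgeRow R′ a ≡ suc (edgeRow R a)
  rowA = count-insert b (trans (cong (_∧ R a b) a<?b) Rab) (trans (cong (_∧ R′ a b) a<?b) R′ab)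
    λ j j≢b → cong (⌊ toℕ a <? toℕ j ⌋ ∧_) (others a j λ
      { (inj₁ (_ , j≡b)) → j≢b j≡b ; (inj₂ (a≡b , _)) → a≢b a≡b })
  -- in a row i ≠ a the only changed entry could be (b , a), which lies below the diagonal
  otherRows : ∀ i → ¬ i ≡ a → edgeRow R′ i ≡ edgeRow R i
  otherRows i i≢a = count-cong entry
    where
    entry : ∀ j → (⌊ toℕ i <? toℕ j ⌋ ∧ R′ i j) ≡ (⌊ toℕ i <? toℕ j ⌋ ∧ R i j)
    entry j with samePair? i j a b
    ... | no ¬same = cong (⌊ toℕ i <? toℕ j ⌋ ∧_) (others i j ¬same)
    ... | yes (inj₁ (i≡a , _)) = ⊥-elim (i≢a i≡a)
    ... | yes (inj₂ (refl , refl)) rewrite ⌊⌋-false (toℕ i <? toℕ j) (<-asym a<b) = refl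

∨-pairInd-outside : ∀ {n} (R : Fin n → Fin n → Bool) {x y i j : Fin n} →
  ¬ SamePair i j x y → (R i j ∨ pairInd x y i j) ≡ R i j
∨-pairInd-outside R {x} {y} {i} {j} ¬same =
  trans (cong (R i j ∨_) (⌊⌋-false (samePair? i j x y) ¬same)) (∨-identityʳ (R i j))

edgeCount-insertPair : ∀ {n} (R : Fin n → Fin n → Bool) (x y : Fin n) → ¬ x ≡ y →
  R x y ≡ false → R y x ≡ false → edgeCount (λ i j → R i j ∨ pairInd x y i j) ≡ suc (edgeCount R)
edgeCount-insertPair R x y x≢y Rxy Ryx with <-cmp (toℕ x) (toℕ y)
... | tri< x<y _ _ =
  edgeCount-insert x y x<y Rxy (∨-trueʳ (R x y) (⌊⌋-true (samePair? x y x y) samePair-refl))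
    λ i j ¬same → ∨-pairInd-outside R ¬same
... | tri≈ _ x≡y _ = ⊥-elim (x≢y (toℕ-injective x≡y))
... | tri> _ _ y<x =
  edgeCount-insert y x y<x Ryx (∨-trueʳ (R y x) (⌊⌋-true (samePair? y x x y) (samePair-swap samePair-refl)))
    λ i j ¬same → ∨-pairInd-outside R λ s → ¬same (samePair-trans s (samePair-swap samePair-refl))

module _ {n : ℕ} (G : Graph n) where

  adj-sym : ∀ {a b} → E G a b → E G b a
  adj-sym {a} {b} h = trans (Graph.sym G b a) h

  adj-≢ : ∀ {a b} → E G a b → ¬ a ≡ b
  adj-≢ {a} h refl = false≢true (trans (sym (irrefl G a)) h)

  module _ (H : Subgraph G) where

    es-swap : ∀ {a b} → es H a b ≡ true → es H b a ≡ true
    es-swap {a} {b} h = trans (es-sym H b a) h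

    es-adj : ∀ {a b} → es H a b ≡ true → E G a b
    es-adj {a} {b} = es-sub H a b

    es-vsˡ : ∀ {a b} → es H a b ≡ true → vs H a ≡ true
    es-vsˡ {a} {b} h = proj₁ (es-vs H a b h)

    es-vsʳ : ∀ {a b} → es H a b ≡ true → vs H b ≡ true
    es-vsʳ {a} {b} h = proj₂ (es-vs H a b h)

    es-outside : ∀ {x y} → vs H y ≡ false → es H x y ≡ false
    es-outside {x} {y} y∉H = not-true λ e → false≢true (trans (sym y∉H) (es-vsʳ e))

    outside-≢ : ∀ {x r} → vs H r ≡ false → vs H x ≡ true → ¬ x ≡ r
    outside-≢ r∉H x∈H refl = false≢true (trans (sym r∉H) x∈H)

  addVertex : Subgraph G → Fin n → Subgraph G
  addVertex H r = record
    { vs = λ i → vs H i ∨ ⌊ i ≟ r ⌋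
    ; es = es H
    ; es-sym = es-sym H
    ; es-sub = es-sub H
    ; es-vs = λ i j e → ∨-trueˡ _ (es-vsˡ H e) , ∨-trueˡ _ (es-vsʳ H e) }

  module _ (H : Subgraph G) (r : Fin n) where

    addVertex-new : vs (addVertex H r) r ≡ true
    addVertex-new = ∨-trueʳ (vs H r) (⌊⌋-true (r ≟ r) refl)

    addVertex-old : ∀ {i} → vs H i ≡ true → vs (addVertex H r) i ≡ true
    addVertex-old e = ∨-trueˡ _ e

    addVertex-cases : ∀ {i} → vs (addVertex H r) i ≡ true → vs H i ≡ true ⊎ i ≡ r
    addVertex-cases {i} e with ∨-true {vs H i} e
    ... | inj₁ i∈H = inj₁ i∈H
    ... | inj₂ i≟r = inj₂ (⌊⌋-sound (i ≟ r) i≟r)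

    nV-addVertex : vs H r ≡ false → nV (addVertex H r) ≡ suc (nV H)
    nV-addVertex r∉H = count-insert r r∉H addVertex-new λ i i≢r →
      trans (cong (vs H i ∨_) (⌊⌋-false (i ≟ r) i≢r)) (∨-identityʳ (vs H i))

  addEdge : (H : Subgraph G) (x y : Fin n) → E G x y → vs H x ≡ true → vs H y ≡ true → Subgraph G
  addEdge H x y xy x∈H y∈H = record
    { vs = vs H
    ; es = λ i j → es H i j ∨ pairInd x y i j
    ; es-sym = λ i j → cong₂ _∨_ (es-sym H i j) (pairInd-sym x y i j)
    ; es-sub = λ i j e → [ es-sub H i j , (λ p → onPair (pair p) xy (adj-sym xy)) ]′ (∨-true e)
    ; es-vs = λ i j e → [ es-vs H i j , (λ p → onPair (pair p) (x∈H , y∈H) (y∈H , x∈H)) ]′ (∨-true e) }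
    where
    pair : ∀ {i j} → pairInd x y i j ≡ true → SamePair i j x y
    pair {i} {j} = ⌊⌋-sound (samePair? i j x y)
    onPair : ∀ {i j} {P : Fin n → Fin n → Set} → SamePair i j x y → P x y → P y x → P i j
    onPair (inj₁ (refl , refl)) pxy pyx = pxy
    onPair (inj₂ (refl , refl)) pxy pyx = pyx

  module _ (H : Subgraph G) {x y : Fin n} (xy : E G x y)
           (x∈H : vs H x ≡ true) (y∈H : vs H y ≡ true) where

    private
      H′ : Subgraph G
      H′ = addEdge H x y xy x∈H y∈H

    addEdge-new : es H′ x y ≡ true
    addEdge-new = ∨-trueʳ (es H x y) (⌊⌋-true (samePair? x y x y) samePair-refl)

    addEdge-old : ∀ {i j} → es H i j ≡ true → es H′ i j ≡ true
    addEdge-old e = ∨-trueˡ _ e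

    addEdge-cases : ∀ {i j} → es H′ i j ≡ true → es H i j ≡ true ⊎ SamePair i j x y
    addEdge-cases {i} {j} e with ∨-true {es H i j} e
    ... | inj₁ old = inj₁ old
    ... | inj₂ new = inj₂ (⌊⌋-sound (samePair? i j x y) new)

    nE-addEdge : es H x y ≡ false → nE H′ ≡ suc (nE H)
    nE-addEdge xy∉H = edgeCount-insertPair (es H) x y (adj-≢ xy) xy∉H (trans (es-sym H y x) xy∉H)

  -- Attaching a new vertex r to an edge pq of H, i.e. H + r + pr + qr.  This
  -- adds one vertex and two edges, so it leaves 2|V| - |E| unchanged.
  module Attach (H : Subgraph G) {r p q : Fin n} (pq : es H p q ≡ true) (pr : E G p r) (qr : E G q r)
                (r∉H : vs H r ≡ false) where

    p∈H : vs H p ≡ true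
    p∈H = es-vsˡ H pq

    q∈H : vs H q ≡ true
    q∈H = es-vsʳ H pq

    H₁ : Subgraph G
    H₁ = addVertex H r

    p∈H₁ : vs H₁ p ≡ true
    p∈H₁ = addVertex-old H r p∈H

    q∈H₁ : vs H₁ q ≡ true
    q∈H₁ = addVertex-old H r q∈H

    r∈H₁ : vs H₁ r ≡ true
    r∈H₁ = addVertex-new H r

    H₂ H⁺ : Subgraph G
    H₂ = addEdge H₁ p r pr p∈H₁ r∈H₁
    H⁺ = addEdge H₂ q r qr q∈H₁ r∈H₁

    nV⁺ : nV H⁺ ≡ suc (nV H)
    nV⁺ = nV-addVertex H r r∉H

    nE⁺ : nE H⁺ ≡ suc (suc (nE H))
    nE⁺ = trans (nE-addEdge H₂ qr q∈H₁ r∈H₁ qr∉H₂)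
                (cong suc (nE-addEdge H₁ pr p∈H₁ r∈H₁ (es-outside H r∉H)))
      where
      qr∉H₂ : es H₂ q r ≡ false
      qr∉H₂ = trans (∨-pairInd-outside (es H) λ { (inj₁ (q≡p , _)) → adj-≢ (es-adj H pq) (sym q≡p)
                                                 ; (inj₂ (q≡r , _)) → adj-≢ qr q≡r })
                    (es-outside H r∉H)

    es⁺-old : ∀ {i j} → es H i j ≡ true → es H⁺ i j ≡ true
    es⁺-old e = addEdge-old H₂ qr q∈H₁ r∈H₁ (addEdge-old H₁ pr p∈H₁ r∈H₁ e)

    es⁺-pr : es H⁺ p r ≡ true
    es⁺-pr = addEdge-old H₂ qr q∈H₁ r∈H₁ (addEdge-new H₁ pr p∈H₁ r∈H₁)

    es⁺-qr : es H⁺ q r ≡ true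
    es⁺-qr = addEdge-new H₂ qr q∈H₁ r∈H₁

    es⁺-cases : ∀ {i j} → es H⁺ i j ≡ true →
                es H i j ≡ true ⊎ SamePair i j p r ⊎ SamePair i j q r
    es⁺-cases e with addEdge-cases H₂ qr q∈H₁ r∈H₁ e
    ... | inj₂ new-qr = inj₂ (inj₂ new-qr)
    ... | inj₁ e₂ with addEdge-cases H₁ pr p∈H₁ r∈H₁ e₂
    ... | inj₁ old = inj₁ old
    ... | inj₂ new-pr = inj₂ (inj₁ new-pr)

    es⁺-at-r : ∀ {j} → es H⁺ r j ≡ true → j ≡ p ⊎ j ≡ q
    es⁺-at-r e with es⁺-cases e
    ... | inj₁ old = ⊥-elim (false≢true (trans (sym r∉H) (es-vsˡ H old)))
    ... | inj₂ (inj₁ (inj₁ (r≡p , _))) = ⊥-elim (adj-≢ pr (sym r≡p))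
    ... | inj₂ (inj₁ (inj₂ (_ , j≡p))) = inj₁ j≡p
    ... | inj₂ (inj₂ (inj₁ (r≡q , _))) = ⊥-elim (adj-≢ qr (sym r≡q))
    ... | inj₂ (inj₂ (inj₂ (_ , j≡q))) = inj₂ j≡q

    es⁺-away : ∀ {i j} → ¬ i ≡ p → ¬ i ≡ q → ¬ i ≡ r →
               es H⁺ i j ≡ true → es H i j ≡ true
    es⁺-away i≢p i≢q i≢r e with es⁺-cases e
    ... | inj₁ old = old
    ... | inj₂ (inj₁ (inj₁ (i≡p , _))) = ⊥-elim (i≢p i≡p)
    ... | inj₂ (inj₁ (inj₂ (i≡r , _))) = ⊥-elim (i≢r i≡r)
    ... | inj₂ (inj₂ (inj₁ (i≡q , _))) = ⊥-elim (i≢q i≡q)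
    ... | inj₂ (inj₂ (inj₂ (i≡r , _))) = ⊥-elim (i≢r i≡r)

  EdgesInTwoTriangles : Set
  EdgesInTwoTriangles = ∀ u v w → Triangle G u v w → ∃[ w′ ] (¬ w′ ≡ w × Triangle G u v w′)

  Closed : Subgraph G → Set
  Closed H = ∀ p q r → es H p q ≡ true → E G p r → E G q r → es H p r ≡ true

  -- Edges are recorded as ordered pairs; the list X of "surplus" edges
  -- collects the edges whose addition lowered 2|V| - |E|.
  Edge : Set
  Edge = Fin n × Fin n

  XNeighbour : List Edge → Fin n → Fin n → Set
  XNeighbour X a q = (a , q) ∈ X ⊎ (q , a) ∈ X

  Joins : Edge → Fin n → Fin n → Set
  Joins (x , y) a b = SamePair x y a b

  Meets : Edge → Fin n → Set
  Meets (x , y) a = x ≡ a ⊎ y ≡ a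

  Avoids : Fin n → Fin n → Fin n → Set
  Avoids a x y = ¬ a ≡ x × ¬ a ≡ y

  -- A slot records one unit of the deficit that prevents H from closing up.
  -- 'tip a b c': a is the tip of a triangle abc of H hanging on bc, and a
  -- has no H-neighbours other than b, c and its X-neighbours; the second
  -- triangle on ab then forces a surplus edge at a.  'spent x y': the
  -- deficit was paid by the surplus edge xy ∈ X.
  data Slot : Set where
    tip   : Fin n → Fin n → Fin n → Slot
    spent : Fin n → Fin n → Slot

  TipNeighbours : Subgraph G → List Edge → Fin n → Fin n → Fin n → Set
  TipNeighbours H X a b c = ∀ q → es H a q ≡ true → q ≡ b ⊎ q ≡ c ⊎ XNeighbour X a q

  SlotOK : Subgraph G → List Edge → Slot → Set
  SlotOK H X (tip a b c) = es H a b ≡ true × es H a c ≡ true × E G b c × TipNeighbours H X a b c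
  SlotOK H X (spent x y) = (x , y) ∈ X

  -- Two slots are separated when they cannot be paid by the same surplus edge.
  Separated : Slot → Slot → Set
  Separated (tip a b c) (tip a′ b′ c′) =
    ¬ a ≡ a′ × Avoids a b′ c′ × Avoids a′ b c × ¬ SamePair b c b′ c′
  Separated (tip a b c) (spent x y) = Avoids a x y
  Separated (spent x y) (tip a b c) = Avoids a x y
  Separated (spent x y) (spent x′ y′) = ¬ SamePair x y x′ y′

  separated-sym : ∀ s t → Separated s t → Separated t s
  separated-sym (tip a b c) (tip a′ b′ c′) (a≢a′ , a∉b′c′ , a′∉bc , ¬same) =
    (a≢a′ ∘ sym) , a′∉bc , a∉b′c′ , (¬same ∘ samePair-sym)
  separated-sym (tip a b c) (spent x y) sep = sep
  separated-sym (spent x y) (tip a b c) sep = sep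
  separated-sym (spent x y) (spent x′ y′) ¬same = ¬same ∘ samePair-sym

  record Slots (H : Subgraph G) (X : List Edge) : Set where
    field
      s₁ s₂ s₃ : Slot
      ok₁ : SlotOK H X s₁
      ok₂ : SlotOK H X s₂
      ok₃ : SlotOK H X s₃
      sep₁₂ : Separated s₁ s₂
      sep₁₃ : Separated s₁ s₃
      sep₂₃ : Separated s₂ s₃

  tip-flip : ∀ {H X a b c} → SlotOK H X (tip a b c) → SlotOK H X (tip a c b)
  tip-flip (ab , ac , bc , nbrs) = ac , ab , adj-sym bc , λ q aq → reorder (nbrs q aq)
    where
    reorder : ∀ {q b c} {P : Set} → q ≡ b ⊎ q ≡ c ⊎ P → q ≡ c ⊎ q ≡ b ⊎ P
    reorder (inj₁ q≡b) = inj₂ (inj₁ q≡b)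
    reorder (inj₂ (inj₁ q≡c)) = inj₁ q≡c
    reorder (inj₂ (inj₂ p)) = inj₂ (inj₂ p)

  joins-meets : ∀ {e a b} → Joins e a b → Meets e a
  joins-meets {x , y} (inj₁ (x≡a , _)) = inj₁ x≡a
  joins-meets {x , y} (inj₂ (_ , y≡a)) = inj₂ y≡a

  joins-swap : ∀ {e a b} → Joins e a b → Joins e b a
  joins-swap {x , y} s = samePair-trans s (samePair-swap samePair-refl)

  joins-other : ∀ {e a b q} → ¬ a ≡ b → Joins e a b → Joins e a q → q ≡ b
  joins-other {x , y} a≢b (inj₁ (refl , refl)) (inj₁ (_ , refl)) = refl
  joins-other {x , y} a≢b (inj₁ (refl , refl)) (inj₂ (_ , y≡x)) = ⊥-elim (a≢b (sym y≡x))
  joins-other {x , y} a≢b (inj₂ (refl , refl)) (inj₁ (x≡y , _)) = ⊥-elim (a≢b (sym x≡y))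
  joins-other {x , y} a≢b (inj₂ (refl , refl)) (inj₂ (refl , _)) = refl

  meets-two : ∀ {e a b} → Meets e a → Meets e b → ¬ a ≡ b → Joins e a b
  meets-two {x , y} (inj₁ refl) (inj₁ refl) a≢b = ⊥-elim (a≢b refl)
  meets-two {x , y} (inj₁ refl) (inj₂ refl) a≢b = inj₁ (refl , refl)
  meets-two {x , y} (inj₂ refl) (inj₁ refl) a≢b = inj₂ (refl , refl)
  meets-two {x , y} (inj₂ refl) (inj₂ refl) a≢b = ⊥-elim (a≢b refl)

  meets-three : ∀ {e a b c} → Meets e a → Meets e b → Meets e c →
                ¬ a ≡ b → ¬ b ≡ c → ¬ a ≡ c → ⊥
  meets-three {x , y} (inj₁ refl) (inj₁ refl) _ a≢b _ _ = a≢b refl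
  meets-three {x , y} (inj₂ refl) (inj₂ refl) _ a≢b _ _ = a≢b refl
  meets-three {x , y} (inj₁ refl) (inj₂ refl) (inj₁ refl) _ _ a≢c = a≢c refl
  meets-three {x , y} (inj₁ refl) (inj₂ refl) (inj₂ refl) _ b≢c _ = b≢c refl
  meets-three {x , y} (inj₂ refl) (inj₁ refl) (inj₁ refl) _ b≢c _ = b≢c refl
  meets-three {x , y} (inj₂ refl) (inj₁ refl) (inj₂ refl) _ _ a≢c = a≢c refl

  meets? : ∀ e a → Dec (Meets e a)
  meets? (x , y) a = (x ≟ a) ⊎-dec (y ≟ a)

  avoids-one-of : ∀ {a b c t} → Avoids a b c → (t ≡ b ⊎ t ≡ c) → ¬ a ≡ t
  avoids-one-of (a≢b , _) (inj₁ refl) = a≢b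
  avoids-one-of (_ , a≢c) (inj₂ refl) = a≢c

  avoids-¬meets : ∀ {a x y} → Avoids a x y → ¬ Meets (x , y) a
  avoids-¬meets (a≢x , _) (inj₁ x≡a) = a≢x (sym x≡a)
  avoids-¬meets (_ , a≢y) (inj₂ y≡a) = a≢y (sym y≡a)

  WithinTwo : List Edge → Edge → Edge → Set
  WithinTwo X γ δ = ∀ {e} → e ∈ X → e ≡ γ ⊎ e ≡ δ

  withinTwo-swap : ∀ {X γ δ} → WithinTwo X γ δ → WithinTwo X δ γ
  withinTwo-swap within m = Data.Sum.swap (within m)

  xNeighbour-within : ∀ {X γ δ a q} → WithinTwo X γ δ → XNeighbour X a q →
                      Joins γ a q ⊎ Joins δ a q
  xNeighbour-within within (inj₁ m) with within m
  ... | inj₁ refl = inj₁ samePair-refl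
  ... | inj₂ refl = inj₂ samePair-refl
  xNeighbour-within within (inj₂ m) with within m
  ... | inj₁ refl = inj₁ (samePair-swap samePair-refl)
  ... | inj₂ refl = inj₂ (samePair-swap samePair-refl)

  withinTwo-of-length : ∀ (X : List Edge) → length X ≤ 2 → Edge → ∃[ γ ] ∃[ δ ] WithinTwo X γ δ
  withinTwo-of-length [] _ d = d , d , λ ()
  withinTwo-of-length (e ∷ []) _ d = e , e , λ { (here refl) → inj₁ refl }
  withinTwo-of-length (e ∷ e′ ∷ []) _ d =
    e , e′ , λ { (here refl) → inj₁ refl ; (there (here refl)) → inj₂ refl }
  withinTwo-of-length (_ ∷ _ ∷ _ ∷ _) (s≤s (s≤s ()))

  module Terminal (twoTriangles : EdgesInTwoTriangles) (H : Subgraph G) (X : List Edge)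
                  (closed : Closed H) where

    OK : Slot → Set
    OK = SlotOK H X

    -- In a closed H the second triangle abq on the edge ab of a tip slot lies
    -- in H, and q ∉ {b, c}: so q is an X-neighbour of the tip a, and bq ∈ H.
    secondTriangle : ∀ {a b c} → OK (tip a b c) → Σ (Fin n) λ q → XNeighbour X a q × es H b q ≡ true
    secondTriangle {a} {b} {c} (ab , ac , bc , nbrs) with twoTriangles a b c (es-adj H ab , bc , es-adj H ac)
    ... | q , q≢c , (_ , bq , aq) with nbrs q (closed a b q ab aq bq)
    ... | inj₁ refl = ⊥-elim (adj-≢ bq refl)
    ... | inj₂ (inj₁ q≡c) = ⊥-elim (q≢c q≡c)
    ... | inj₂ (inj₂ xq) = q , xq , closed b a q (es-swap H ab) bq aq

    tip-meets : ∀ {a b c γ δ} → WithinTwo X γ δ → OK (tip a b c) → Meets γ a ⊎ Meets δ a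
    tip-meets within ok with xNeighbour-within within (proj₁ (proj₂ (secondTriangle ok)))
    ... | inj₁ joinsγ = inj₁ (joins-meets joinsγ)
    ... | inj₂ joinsδ = inj₂ (joins-meets joinsδ)

    -- If the only X-neighbour of the tip a₁ is a₂, both second triangles on
    -- a₁b₁ and a₁c₁ go through a₂; since {b₁, c₁} ≠ {b₂, c₂} the tip a₂ must
    -- then have an X-neighbour in {b₁, c₁}.
    partner : ∀ {a₁ b₁ c₁ a₂ b₂ c₂} → OK (tip a₁ b₁ c₁) → OK (tip a₂ b₂ c₂) →
              Separated (tip a₁ b₁ c₁) (tip a₂ b₂ c₂) → (∀ q → XNeighbour X a₁ q → q ≡ a₂) →
              Σ (Fin n) λ t → XNeighbour X a₂ t × (t ≡ b₁ ⊎ t ≡ c₁)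
    partner {a₁} {b₁} {c₁} ok₁@(_ , _ , b₁c₁ , _) (_ , _ , _ , nbrs₂) (_ , _ , _ , ¬same) only
      with secondTriangle ok₁ | secondTriangle (tip-flip {H} {X} ok₁)
    ... | q , xq , b₁q | q′ , xq′ , c₁q′ with only q xq | only q′ xq′
    ... | refl | refl with nbrs₂ b₁ (es-swap H b₁q) | nbrs₂ c₁ (es-swap H c₁q′)
    ... | inj₂ (inj₂ xb₁) | _ = b₁ , xb₁ , inj₁ refl
    ... | _ | inj₂ (inj₂ xc₁) = c₁ , xc₁ , inj₂ refl
    ... | inj₁ b₁≡b₂ | inj₁ c₁≡b₂ = ⊥-elim (adj-≢ b₁c₁ (trans b₁≡b₂ (sym c₁≡b₂)))
    ... | inj₁ b₁≡b₂ | inj₂ (inj₁ c₁≡c₂) = ⊥-elim (¬same (inj₁ (b₁≡b₂ , c₁≡c₂)))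
    ... | inj₂ (inj₁ b₁≡c₂) | inj₁ c₁≡b₂ = ⊥-elim (¬same (inj₂ (b₁≡c₂ , c₁≡b₂)))
    ... | inj₂ (inj₁ b₁≡c₂) | inj₂ (inj₁ c₁≡c₂) = ⊥-elim (adj-≢ b₁c₁ (trans b₁≡c₂ (sym c₁≡c₂)))

    shared-edge : ∀ {a₁ b₁ c₁ a₂ b₂ c₂ γ δ} → WithinTwo X γ δ → OK (tip a₁ b₁ c₁) → OK (tip a₂ b₂ c₂) →
      Separated (tip a₁ b₁ c₁) (tip a₂ b₂ c₂) → Joins γ a₁ a₂ → ¬ Meets δ a₁ →
      (∀ t → (t ≡ b₁ ⊎ t ≡ c₁) → ¬ Joins δ a₂ t) → ⊥
    shared-edge {a₁} {b₁} {c₁} {a₂} within ok₁@(a₁b₁ , a₁c₁ , _) ok₂ sep@(a₁≢a₂ , _) γ₁₂ δ∌a₁ δ-far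
      with partner ok₁ ok₂ sep only
      where
      only : ∀ q → XNeighbour X a₁ q → q ≡ a₂
      only q xq with xNeighbour-within within xq
      ... | inj₁ γ₁q = joins-other a₁≢a₂ γ₁₂ γ₁q
      ... | inj₂ δ₁q = ⊥-elim (δ∌a₁ (joins-meets δ₁q))
    ... | t , xt , t∈b₁c₁ with xNeighbour-within within xt
    ... | inj₂ δ₂t = δ-far t t∈b₁c₁ δ₂t
    ... | inj₁ γ₂t with joins-other (a₁≢a₂ ∘ sym) (joins-swap γ₁₂) γ₂t
    ... | refl = avoids-one-of (adj-≢ (es-adj H a₁b₁) , adj-≢ (es-adj H a₁c₁)) t∈b₁c₁ refl

    -- Three tips, two of which share the surplus edge γ: the third tip's
    -- surplus edge is δ, and whichever of a₁, a₂ it misses contradicts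
    -- 'shared-edge'.
    three-tips-sharing : ∀ {a₁ b₁ c₁ a₂ b₂ c₂ a₃ b₃ c₃ γ δ} → WithinTwo X γ δ →
      OK (tip a₁ b₁ c₁) → OK (tip a₂ b₂ c₂) → OK (tip a₃ b₃ c₃) →
      Separated (tip a₁ b₁ c₁) (tip a₂ b₂ c₂) → Separated (tip a₁ b₁ c₁) (tip a₃ b₃ c₃) →
      Separated (tip a₂ b₂ c₂) (tip a₃ b₃ c₃) → Joins γ a₁ a₂ → ⊥
    three-tips-sharing {δ = δ} within ok₁ ok₂ ok₃ s₁₂@(a₁≢a₂ , a₁∉b₂c₂ , a₂∉b₁c₁ , _)
                       (a₁≢a₃ , _ , a₃∉b₁c₁ , _) (a₂≢a₃ , _ , a₃∉b₂c₂ , _) γ₁₂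
      with tip-meets within ok₃
    ... | inj₁ γ∋a₃ = meets-three (joins-meets γ₁₂) (joins-meets (joins-swap γ₁₂)) γ∋a₃ a₁≢a₂ a₂≢a₃ a₁≢a₃
    ... | inj₂ δ∋a₃ with meets? δ _
    ... | no δ∌a₁ = shared-edge within ok₁ ok₂ s₁₂ γ₁₂ δ∌a₁ λ t t∈b₁c₁ δ₂t →
          meets-three (joins-meets δ₂t) (joins-meets (joins-swap δ₂t)) δ∋a₃
            (avoids-one-of a₂∉b₁c₁ t∈b₁c₁) (λ t≡a₃ → avoids-one-of a₃∉b₁c₁ t∈b₁c₁ (sym t≡a₃)) a₂≢a₃
    ... | yes δ∋a₁ =
          shared-edge within ok₂ ok₁ (separated-sym (tip _ _ _) (tip _ _ _) s₁₂) (joins-swap γ₁₂) δ∌a₂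
            λ t t∈b₂c₂ δ₁t → meets-three (joins-meets δ₁t) (joins-meets (joins-swap δ₁t)) δ∋a₃
              (avoids-one-of a₁∉b₂c₂ t∈b₂c₂) (λ t≡a₃ → avoids-one-of a₃∉b₂c₂ t∈b₂c₂ (sym t≡a₃)) a₁≢a₃
      where
      δ∌a₂ : ¬ Meets δ _
      δ∌a₂ δ∋a₂ = meets-three δ∋a₁ δ∋a₂ δ∋a₃ a₁≢a₂ a₂≢a₃ a₁≢a₃

    -- Three tips: by pigeonhole two of them meet the same surplus edge.
    three-tips : ∀ {a₁ b₁ c₁ a₂ b₂ c₂ a₃ b₃ c₃ γ δ} → WithinTwo X γ δ →
      OK (tip a₁ b₁ c₁) → OK (tip a₂ b₂ c₂) → OK (tip a₃ b₃ c₃) →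
      Separated (tip a₁ b₁ c₁) (tip a₂ b₂ c₂) → Separated (tip a₁ b₁ c₁) (tip a₃ b₃ c₃) →
      Separated (tip a₂ b₂ c₂) (tip a₃ b₃ c₃) → ⊥
    three-tips {a₁} {b₁} {c₁} {a₂} {b₂} {c₂} {a₃} {b₃} {c₃} {γ} {δ} within ok₁ ok₂ ok₃ s₁₂ s₁₃ s₂₃ =
      pigeonhole (tip-meets within ok₁) (tip-meets within ok₂) (tip-meets within ok₃)
      where
      within′ : WithinTwo X δ γ
      within′ = withinTwo-swap within
      s₂₁ : Separated (tip a₂ b₂ c₂) (tip a₁ b₁ c₁)
      s₂₁ = separated-sym (tip a₁ b₁ c₁) (tip a₂ b₂ c₂) s₁₂
      s₃₁ : Separated (tip a₃ b₃ c₃) (tip a₁ b₁ c₁)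
      s₃₁ = separated-sym (tip a₁ b₁ c₁) (tip a₃ b₃ c₃) s₁₃
      s₃₂ : Separated (tip a₃ b₃ c₃) (tip a₂ b₂ c₂)
      s₃₂ = separated-sym (tip a₂ b₂ c₂) (tip a₃ b₃ c₃) s₂₃
      pigeonhole : Meets γ a₁ ⊎ Meets δ a₁ → Meets γ a₂ ⊎ Meets δ a₂ → Meets γ a₃ ⊎ Meets δ a₃ → ⊥
      pigeonhole (inj₁ m₁) (inj₁ m₂) _ =
        three-tips-sharing within ok₁ ok₂ ok₃ s₁₂ s₁₃ s₂₃ (meets-two m₁ m₂ (proj₁ s₁₂))
      pigeonhole (inj₂ m₁) (inj₂ m₂) _ =
        three-tips-sharing within′ ok₁ ok₂ ok₃ s₁₂ s₁₃ s₂₃ (meets-two m₁ m₂ (proj₁ s₁₂))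
      pigeonhole (inj₁ m₁) (inj₂ _) (inj₁ m₃) =
        three-tips-sharing within ok₁ ok₃ ok₂ s₁₃ s₁₂ s₃₂ (meets-two m₁ m₃ (proj₁ s₁₃))
      pigeonhole (inj₂ m₁) (inj₁ _) (inj₂ m₃) =
        three-tips-sharing within′ ok₁ ok₃ ok₂ s₁₃ s₁₂ s₃₂ (meets-two m₁ m₃ (proj₁ s₁₃))
      pigeonhole (inj₁ _) (inj₂ m₂) (inj₂ m₃) =
        three-tips-sharing within′ ok₂ ok₃ ok₁ s₂₃ s₂₁ s₃₁ (meets-two m₂ m₃ (proj₁ s₂₃))
      pigeonhole (inj₂ _) (inj₁ m₂) (inj₁ m₃) =
        three-tips-sharing within ok₂ ok₃ ok₁ s₂₃ s₂₁ s₃₁ (meets-two m₂ m₃ (proj₁ s₂₃))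

    -- Two tips avoiding the surplus edge γ = xy both use δ, contradicting 'shared-edge'.
    two-tips-avoiding : ∀ {a₁ b₁ c₁ a₂ b₂ c₂ x y δ} → WithinTwo X (x , y) δ →
      OK (tip a₁ b₁ c₁) → OK (tip a₂ b₂ c₂) →
      Separated (tip a₁ b₁ c₁) (tip a₂ b₂ c₂) → Avoids a₁ x y → Avoids a₂ x y → ⊥
    two-tips-avoiding within ok₁ ok₂ s₁₂ a₁∉xy a₂∉xy with tip-meets within ok₁ | tip-meets within ok₂
    ... | inj₁ γ∋a₁ | _ = avoids-¬meets a₁∉xy γ∋a₁
    ... | _ | inj₁ γ∋a₂ = avoids-¬meets a₂∉xy γ∋a₂
    ... | inj₂ δ∋a₁ | inj₂ δ∋a₂ =
      shared-edge (withinTwo-swap within) ok₁ ok₂ s₁₂ (meets-two δ∋a₁ δ∋a₂ (proj₁ s₁₂))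
        (avoids-¬meets a₁∉xy) λ t _ γ₂t → avoids-¬meets a₂∉xy (joins-meets γ₂t)

    -- Two tips and a spent slot xy: xy is one of γ, δ and both tips avoid it.
    two-tips : ∀ {a₁ b₁ c₁ a₂ b₂ c₂ x y γ δ} → WithinTwo X γ δ →
      OK (tip a₁ b₁ c₁) → OK (tip a₂ b₂ c₂) → OK (spent x y) →
      Separated (tip a₁ b₁ c₁) (tip a₂ b₂ c₂) → Avoids a₁ x y → Avoids a₂ x y → ⊥
    two-tips within ok₁ ok₂ xy s₁₂ a₁∉xy a₂∉xy with within xy
    ... | inj₁ refl = two-tips-avoiding within ok₁ ok₂ s₁₂ a₁∉xy a₂∉xy
    ... | inj₂ refl = two-tips-avoiding (withinTwo-swap within) ok₁ ok₂ s₁₂ a₁∉xy a₂∉xy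

    -- One tip and two spent slots: the spent edges are γ and δ, and the
    -- tip avoids both.
    one-tip : ∀ {a b c x y x′ y′ γ δ} → WithinTwo X γ δ → OK (tip a b c) → OK (spent x y) → OK (spent x′ y′) →
      Avoids a x y → Avoids a x′ y′ → ¬ SamePair x y x′ y′ → ⊥
    one-tip within ok xy x′y′ a∉xy a∉x′y′ ¬same with within xy | within x′y′ | tip-meets within ok
    ... | inj₁ refl | inj₁ refl | _ = ¬same samePair-refl
    ... | inj₂ refl | inj₂ refl | _ = ¬same samePair-refl
    ... | inj₁ refl | inj₂ refl | inj₁ γ∋a = avoids-¬meets a∉xy γ∋a
    ... | inj₁ refl | inj₂ refl | inj₂ δ∋a = avoids-¬meets a∉x′y′ δ∋a
    ... | inj₂ refl | inj₁ refl | inj₁ γ∋a = avoids-¬meets a∉x′y′ γ∋a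
    ... | inj₂ refl | inj₁ refl | inj₂ δ∋a = avoids-¬meets a∉xy δ∋a

    -- Three spent slots are three different edges among γ and δ.
    no-tip : ∀ {x₁ y₁ x₂ y₂ x₃ y₃ γ δ} → WithinTwo X γ δ →
      OK (spent x₁ y₁) → OK (spent x₂ y₂) → OK (spent x₃ y₃) →
      ¬ SamePair x₁ y₁ x₂ y₂ → ¬ SamePair x₁ y₁ x₃ y₃ → ¬ SamePair x₂ y₂ x₃ y₃ → ⊥
    no-tip within m₁ m₂ m₃ ¬s₁₂ ¬s₁₃ ¬s₂₃ with within m₁ | within m₂ | within m₃
    ... | inj₁ refl | inj₁ refl | _ = ¬s₁₂ samePair-refl
    ... | inj₂ refl | inj₂ refl | _ = ¬s₁₂ samePair-refl
    ... | inj₁ refl | inj₂ refl | inj₁ refl = ¬s₁₃ samePair-refl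
    ... | inj₁ refl | inj₂ refl | inj₂ refl = ¬s₂₃ samePair-refl
    ... | inj₂ refl | inj₁ refl | inj₁ refl = ¬s₂₃ samePair-refl
    ... | inj₂ refl | inj₁ refl | inj₂ refl = ¬s₁₃ samePair-refl

    terminal : ∀ {γ δ} → WithinTwo X γ δ → Slots H X → ⊥
    terminal within S = by-kind s₁ s₂ s₃ ok₁ ok₂ ok₃ sep₁₂ sep₁₃ sep₂₃
      where
      open Slots S
      by-kind : ∀ s₁ s₂ s₃ → OK s₁ → OK s₂ → OK s₃ → Separated s₁ s₂ → Separated s₁ s₃ → Separated s₂ s₃ → ⊥
      by-kind (tip _ _ _) (tip _ _ _) (tip _ _ _) o₁ o₂ o₃ s₁₂ s₁₃ s₂₃ = three-tips within o₁ o₂ o₃ s₁₂ s₁₃ s₂₃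
      by-kind (tip _ _ _) (tip _ _ _) (spent _ _) o₁ o₂ o₃ s₁₂ s₁₃ s₂₃ = two-tips within o₁ o₂ o₃ s₁₂ s₁₃ s₂₃
      by-kind (tip _ _ _) (spent _ _) (tip _ _ _) o₁ o₂ o₃ s₁₂ s₁₃ s₂₃ = two-tips within o₁ o₃ o₂ s₁₃ s₁₂ s₂₃
      by-kind (spent _ _) (tip _ _ _) (tip _ _ _) o₁ o₂ o₃ s₁₂ s₁₃ s₂₃ = two-tips within o₂ o₃ o₁ s₂₃ s₁₂ s₁₃
      by-kind (tip _ _ _) (spent _ _) (spent _ _) o₁ o₂ o₃ s₁₂ s₁₃ s₂₃ = one-tip within o₁ o₂ o₃ s₁₂ s₁₃ s₂₃
      by-kind (spent _ _) (tip _ _ _) (spent _ _) o₁ o₂ o₃ s₁₂ s₁₃ s₂₃ = one-tip within o₂ o₁ o₃ s₁₂ s₂₃ s₁₃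
      by-kind (spent _ _) (spent _ _) (tip _ _ _) o₁ o₂ o₃ s₁₂ s₁₃ s₂₃ = one-tip within o₃ o₁ o₂ s₁₃ s₂₃ s₁₂
      by-kind (spent _ _) (spent _ _) (spent _ _) o₁ o₂ o₃ s₁₂ s₁₃ s₂₃ = no-tip within o₁ o₂ o₃ s₁₂ s₁₃ s₂₃

  -- The invariant of the growth process: 2|V(H)| + |X| ≤ |E(H)| + 3, so
  -- that f(H) ≤ 3 - |X|; the surplus edges X are edges of H; and H carries
  -- three pairwise separated slots.
  record Invariant (H : Subgraph G) (X : List Edge) : Set where
    field
      deficit : 2 * nV H + length X ≤ nE H + 3
      surplus⊆H : ∀ {x y} → (x , y) ∈ X → es H x y ≡ true
      slots : Slots H X

  invariant-edge : ∀ {H X} → Invariant H X → ∃[ i ] ∃[ j ] es H i j ≡ true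
  invariant-edge {H} {X} I = slot-edge (Slots.s₁ slots) (Slots.ok₁ slots)
    where
    open Invariant I
    slot-edge : ∀ s → SlotOK H X s → ∃[ i ] ∃[ j ] es H i j ≡ true
    slot-edge (tip a b c) (ab , _) = a , b , ab
    slot-edge (spent x y) xy = x , y , surplus⊆H xy

  -- Adding an edge pr of G between two vertices of H, and recording it as a
  -- surplus edge, preserves the invariant: f drops by one while |X| grows by one.
  module EdgeStep {H : Subgraph G} {X : List Edge} {p r : Fin n} (pr : E G p r)
                  (p∈H : vs H p ≡ true) (r∈H : vs H r ≡ true) where

    H⁺ : Subgraph G
    H⁺ = addEdge H p r pr p∈H r∈H

    X⁺ : List Edge
    X⁺ = (p , r) ∷ X

    slotOK⁺ : ∀ s → SlotOK H X s → SlotOK H⁺ X⁺ s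
    slotOK⁺ (spent x y) xy = there xy
    slotOK⁺ (tip a b c) (ab , ac , bc , nbrs) =
      addEdge-old H pr p∈H r∈H ab , addEdge-old H pr p∈H r∈H ac , bc , nbrs⁺
      where
      nbrs⁺ : TipNeighbours H⁺ X⁺ a b c
      nbrs⁺ t at with addEdge-cases H pr p∈H r∈H at
      ... | inj₂ (inj₁ (refl , refl)) = inj₂ (inj₂ (inj₁ (here refl)))
      ... | inj₂ (inj₂ (refl , refl)) = inj₂ (inj₂ (inj₂ (here refl)))
      ... | inj₁ old with nbrs t old
      ... | inj₁ t≡b = inj₁ t≡b
      ... | inj₂ (inj₁ t≡c) = inj₂ (inj₁ t≡c)
      ... | inj₂ (inj₂ (inj₁ m)) = inj₂ (inj₂ (inj₁ (there m)))
      ... | inj₂ (inj₂ (inj₂ m)) = inj₂ (inj₂ (inj₂ (there m)))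

    invariant⁺ : es H p r ≡ false → Invariant H X → Invariant H⁺ X⁺
    invariant⁺ pr∉H I = record
      { deficit = subst₂ _≤_ (sym (+-suc (2 * nV H) (length X)))
                             (cong (_+ 3) (sym (nE-addEdge H pr p∈H r∈H pr∉H))) (s≤s deficit)
      ; surplus⊆H = λ { (here refl) → addEdge-new H pr p∈H r∈H
                      ; (there m) → addEdge-old H pr p∈H r∈H (surplus⊆H m) }
      ; slots = record
          { s₁ = s₁ ; s₂ = s₂ ; s₃ = s₃
          ; ok₁ = slotOK⁺ s₁ ok₁ ; ok₂ = slotOK⁺ s₂ ok₂ ; ok₃ = slotOK⁺ s₃ ok₃
          ; sep₁₂ = sep₁₂ ; sep₁₃ = sep₁₃ ; sep₂₃ = sep₂₃ } }
      where
      open Invariant I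
      open Slots slots

  module AttachTips (H : Subgraph G) (X : List Edge) {r p q : Fin n} (pq : es H p q ≡ true) (pr : E G p r)
                    (qr : E G q r) (r∉H : vs H r ≡ false) where

    open Attach H pq pr qr r∉H

    new-tip : SlotOK H⁺ X (tip r p q)
    new-tip = es-swap H⁺ es⁺-pr , es-swap H⁺ es⁺-qr , es-adj H pq ,
              λ t rt → [ inj₁ , inj₂ ∘ inj₁ ]′ (es⁺-at-r rt)

    keeps-tip : ∀ {a b c} → Avoids a p q → SlotOK H X (tip a b c) → SlotOK H⁺ X (tip a b c)
    keeps-tip (a≢p , a≢q) (ab , ac , bc , nbrs) =
      es⁺-old ab , es⁺-old ac , bc ,
      λ t at → nbrs t (es⁺-away a≢p a≢q (outside-≢ H r∉H (es-vsˡ H ab)) at)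

  TipAt : Fin n → Slot → Set
  TipAt p (tip a _ _) = a ≡ p
  TipAt p (spent _ _) = ⊥

  tipAt? : ∀ p s → Dec (TipAt p s)
  tipAt? p (tip a _ _) = a ≟ p
  tipAt? p (spent _ _) = no λ ()

  BaseAvoids : Fin n → Slot → Set
  BaseAvoids p (tip _ b c) = Avoids p b c
  BaseAvoids p (spent _ _) = ⊤

  base-avoids-own-tip : ∀ {H X p} s → SlotOK H X s → TipAt p s → BaseAvoids p s
  base-avoids-own-tip {H} (tip a b c) (ab , ac , _) refl = adj-≢ (es-adj H ab) , adj-≢ (es-adj H ac)

  base-avoids-tip : ∀ {p} s t → Separated t s → TipAt p t → BaseAvoids p s
  base-avoids-tip (tip a b c) (tip a′ b′ c′) (_ , a′∉bc , _ , _) refl = a′∉bc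
  base-avoids-tip (spent x y) t _ _ = tt

  TipAmong : ∀ {H X} → Fin n → Slots H X → Set
  TipAmong p S = TipAt p s₁ ⊎ TipAt p s₂ ⊎ TipAt p s₃
    where open Slots S

  tipAmong? : ∀ {H X} p (S : Slots H X) → Dec (TipAmong p S)
  tipAmong? p S = tipAt? p s₁ ⊎-dec tipAt? p s₂ ⊎-dec tipAt? p s₃
    where open Slots S

  tip-avoids-bases : ∀ {H X p} (S : Slots H X) → TipAmong p S →
    BaseAvoids p (Slots.s₁ S) × BaseAvoids p (Slots.s₂ S) × BaseAvoids p (Slots.s₃ S)
  tip-avoids-bases S (inj₁ at₁) =
    base-avoids-own-tip s₁ ok₁ at₁ , base-avoids-tip s₂ s₁ sep₁₂ at₁ , base-avoids-tip s₃ s₁ sep₁₃ at₁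
    where open Slots S
  tip-avoids-bases S (inj₂ (inj₁ at₂)) =
    base-avoids-tip s₁ s₂ (separated-sym s₁ s₂ sep₁₂) at₂ , base-avoids-own-tip s₂ ok₂ at₂ ,
    base-avoids-tip s₃ s₂ sep₂₃ at₂
    where open Slots S
  tip-avoids-bases S (inj₂ (inj₂ at₃)) =
    base-avoids-tip s₁ s₃ (separated-sym s₁ s₃ sep₁₃) at₃ ,
    base-avoids-tip s₂ s₃ (separated-sym s₂ s₃ sep₂₃) at₃ , base-avoids-own-tip s₃ ok₃ at₃
    where open Slots S

  -- Attaching a new vertex r to the edge pq of H breaks the slots with tip p
  -- or q (their tip gains the neighbour r) and is harmless to the others.
  -- A tip at p is replaced by the new tip r on pq.  A tip at q is replaced
  -- by the new tip r on qp, unless a tip at p exists ('tipAtP'): then p is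
  -- not on the base of the q-tip, so qp is a surplus edge, which becomes a
  -- spent slot.
  module AttachStep (H : Subgraph G) (X : List Edge) {r p q : Fin n} (pq : es H p q ≡ true)
                    (pr : E G p r) (qr : E G q r) (r∉H : vs H r ≡ false)
                    (surplus⊆H : ∀ {x y} → (x , y) ∈ X → es H x y ≡ true) (tipAtP : Set) where

    open Attach H pq pr qr r∉H
    open AttachTips H X pq pr qr r∉H

    Stays : Slot → Set
    Stays (tip a _ _) = Avoids a p q
    Stays (spent _ _) = ⊤

    data Moved : Slot → Slot → Set where
      at-p       : ∀ {b c} → Moved (tip p b c) (tip r p q)
      at-q-spent : ∀ {b c x y} → tipAtP → (x , y) ∈ X → SamePair x y p q →
                   Moved (tip q b c) (spent x y)
      at-q       : ∀ {b c} → ¬ tipAtP → Moved (tip q b c) (tip r q p)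

    data Update (s : Slot) : Slot → Set where
      stay  : Stays s → Update s s
      moved : ∀ {s′} → Moved s s′ → Update s s′

    update : ∀ s → SlotOK H X s → Dec tipAtP → (tipAtP → BaseAvoids p s) → Σ Slot (Update s)
    update (spent x y) _ _ _ = spent x y , stay tt
    update (tip a b c) (_ , _ , _ , nbrs) tipAtP? base-avoids-p with a ≟ p | a ≟ q
    ... | yes refl | _ = tip r p q , moved at-p
    ... | no a≢p | no a≢q = tip a b c , stay (a≢p , a≢q)
    ... | no _ | yes refl with tipAtP?
    ...   | no ¬tipAtP = tip r q p , moved (at-q ¬tipAtP)
    ...   | yes atP with nbrs p (es-swap H pq)
    ...     | inj₁ p≡b = ⊥-elim (proj₁ (base-avoids-p atP) p≡b)
    ...     | inj₂ (inj₁ p≡c) = ⊥-elim (proj₂ (base-avoids-p atP) p≡c)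
    ...     | inj₂ (inj₂ (inj₁ qp∈X)) =
                spent q p , moved (at-q-spent atP qp∈X (samePair-swap samePair-refl))
    ...     | inj₂ (inj₂ (inj₂ pq∈X)) = spent p q , moved (at-q-spent atP pq∈X samePair-refl)

    update-ok : ∀ {s s′} → Update s s′ → SlotOK H X s → SlotOK H⁺ X s′
    update-ok {spent _ _} (stay _) xy = xy
    update-ok {tip a b c} (stay a∉pq) ok = keeps-tip a∉pq ok
    update-ok (moved at-p) _ = new-tip
    update-ok (moved (at-q-spent _ xy _)) _ = xy
    update-ok (moved (at-q _)) _ = tip-flip {H⁺} {X} new-tip

    r-fresh : ∀ {x} → vs H x ≡ true → ¬ r ≡ x
    r-fresh x∈H r≡x = outside-≢ H r∉H x∈H (sym r≡x)

    r-avoids-edge : ∀ {x y} → es H x y ≡ true → Avoids r x y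
    r-avoids-edge xy = r-fresh (es-vsˡ H xy) , r-fresh (es-vsʳ H xy)

    r-avoids-pq : ∀ {x y} → SamePair x y p q → Avoids r x y
    r-avoids-pq (inj₁ (refl , refl)) = r-avoids-edge pq
    r-avoids-pq (inj₂ (refl , refl)) = Data.Product.swap (r-avoids-edge pq)

    avoids-pq : ∀ {a x y} → Avoids a p q → SamePair x y p q → Avoids a x y
    avoids-pq a∉pq (inj₁ (refl , refl)) = a∉pq
    avoids-pq a∉pq (inj₂ (refl , refl)) = Data.Product.swap a∉pq

    stay-moved : ∀ {s t t′} → Stays s → Moved t t′ → SlotOK H X s → Separated s t → Separated s t′
    stay-moved {tip a b c} a∉pq at-p (ab , ac , _) (_ , _ , p∉bc , _) =
      r-fresh (es-vsˡ H ab) ∘ sym , a∉pq , (r-fresh (es-vsʳ H ab) , r-fresh (es-vsʳ H ac)) ,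
      λ same → avoids-one-of p∉bc (samePair-first same) refl
    stay-moved {tip a b c} a∉pq (at-q-spent _ _ same) _ _ = avoids-pq a∉pq same
    stay-moved {tip a b c} (a≢p , a≢q) (at-q _) (ab , ac , _) (_ , _ , q∉bc , _) =
      r-fresh (es-vsˡ H ab) ∘ sym , (a≢q , a≢p) , (r-fresh (es-vsʳ H ab) , r-fresh (es-vsʳ H ac)) ,
      λ same → avoids-one-of q∉bc (samePair-first same) refl
    stay-moved {spent x y} _ at-p xy _ = r-avoids-edge (surplus⊆H xy)
    stay-moved {spent x y} _ (at-q-spent _ _ same′) _ q∉xy same =
      avoids-one-of q∉xy (samePair-second (samePair-trans same same′)) refl
    stay-moved {spent x y} _ (at-q _) xy _ = r-avoids-edge (surplus⊆H xy)

    -- two moved slots are separated: at most one of them is a new tip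
    moved-moved : ∀ {s s′ t t′} → Moved s s′ → Moved t t′ →
                  (TipAt p s → tipAtP) → (TipAt p t → tipAtP) → Separated s t → Separated s′ t′
    moved-moved at-p at-p _ _ (p≢p , _) = ⊥-elim (p≢p refl)
    moved-moved at-p (at-q-spent _ _ same) _ _ _ = r-avoids-pq same
    moved-moved at-p (at-q ¬atP) atP _ _ = ⊥-elim (¬atP (atP refl))
    moved-moved (at-q-spent _ _ same) at-p _ _ _ = r-avoids-pq same
    moved-moved (at-q-spent _ _ _) (at-q-spent _ _ _) _ _ (q≢q , _) = ⊥-elim (q≢q refl)
    moved-moved (at-q-spent _ _ _) (at-q _) _ _ (q≢q , _) = ⊥-elim (q≢q refl)
    moved-moved (at-q ¬atP) at-p _ atP _ = ⊥-elim (¬atP (atP refl))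
    moved-moved (at-q _) (at-q-spent _ _ _) _ _ (q≢q , _) = ⊥-elim (q≢q refl)
    moved-moved (at-q _) (at-q _) _ _ (q≢q , _) = ⊥-elim (q≢q refl)

    update-separated : ∀ {s s′ t t′} → Update s s′ → Update t t′ → SlotOK H X s → SlotOK H X t →
                       (TipAt p s → tipAtP) → (TipAt p t → tipAtP) → Separated s t → Separated s′ t′
    update-separated (stay _) (stay _) _ _ _ _ sep = sep
    update-separated (stay st) (moved m) ok _ _ _ sep = stay-moved st m ok sep
    update-separated {s} {s′} {t} {t′} (moved m) (stay st) _ ok _ _ sep =
      separated-sym t s′ (stay-moved st m ok (separated-sym s t sep))
    update-separated (moved m) (moved m′) _ _ atP atP′ sep = moved-moved m m′ atP atP′ sep

  attach-invariant : ∀ {H X r p q} (pq : es H p q ≡ true) (pr : E G p r) (qr : E G q r)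
                     (r∉H : vs H r ≡ false) → Invariant H X → Invariant (Attach.H⁺ H pq pr qr r∉H) X
  attach-invariant {H} {X} {r} {p} {q} pq pr qr r∉H I = record
    { deficit = subst₂ _≤_ (cong (λ v → 2 * v + length X) (sym nV⁺)) (cong (_+ 3) (sym nE⁺))
                           (deficit-step {nV H} deficit)
    ; surplus⊆H = es⁺-old ∘ surplus⊆H
    ; slots = record
        { s₁ = proj₁ u₁ ; s₂ = proj₁ u₂ ; s₃ = proj₁ u₃
        ; ok₁ = update-ok (proj₂ u₁) ok₁
        ; ok₂ = update-ok (proj₂ u₂) ok₂
        ; ok₃ = update-ok (proj₂ u₃) ok₃
        ; sep₁₂ = update-separated (proj₂ u₁) (proj₂ u₂) ok₁ ok₂ inj₁ (inj₂ ∘ inj₁) sep₁₂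
        ; sep₁₃ = update-separated (proj₂ u₁) (proj₂ u₃) ok₁ ok₃ inj₁ (inj₂ ∘ inj₂) sep₁₃
        ; sep₂₃ = update-separated (proj₂ u₂) (proj₂ u₃) ok₂ ok₃ (inj₂ ∘ inj₁) (inj₂ ∘ inj₂) sep₂₃ } }
    where
    open Invariant I
    open Slots slots
    open Attach H pq pr qr r∉H
    open AttachStep H X pq pr qr r∉H surplus⊆H (TipAmong p slots)

    deficit-step : ∀ {v x e} → 2 * v + x ≤ e + 3 → 2 * suc v + x ≤ suc (suc e) + 3
    deficit-step {v} le rewrite +-suc v (v + 0) = s≤s (s≤s le)

    u₁ : Σ Slot (Update s₁)
    u₂ : Σ Slot (Update s₂)
    u₃ : Σ Slot (Update s₃)
    u₁ = update s₁ ok₁ (tipAmong? p slots) (proj₁ ∘ tip-avoids-bases slots)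
    u₂ = update s₂ ok₂ (tipAmong? p slots) (proj₁ ∘ proj₂ ∘ tip-avoids-bases slots)
    u₃ = update s₃ ok₃ (tipAmong? p slots) (proj₂ ∘ proj₂ ∘ tip-avoids-bases slots)

  Unclosed : Subgraph G → Set
  Unclosed H = ∃[ p ] ∃[ q ] ∃[ r ] (es H p q ≡ true × E G p r × E G q r × es H p r ≡ false)

  unclosed? : ∀ {H} → Dec (Unclosed H)
  unclosed? {H} = any? λ p → any? λ q → any? λ r →
    (es H p q ≟ᵇ true) ×-dec (adj G p r ≟ᵇ true) ×-dec (adj G q r ≟ᵇ true) ×-dec (es H p r ≟ᵇ false)

  closed-or-unclosed : ∀ H → Closed H ⊎ Unclosed H
  closed-or-unclosed H with unclosed? {H}
  ... | yes unclosed = inj₂ unclosed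
  ... | no ¬unclosed = inj₁ closed
    where
    closed : Closed H
    closed p q r pq pr qr with es H p r in pr∈H
    ... | true = refl
    ... | false = ⊥-elim (¬unclosed (p , q , r , pq , pr , qr , pr∈H))

  -- The growth process, in a (2, ℓ)-sparse graph with ℓ ≥ 1.  A subgraph
  -- with the invariant that is closed contradicts 'terminal'; otherwise it
  -- can be enlarged by an edge or by an attached vertex.  Since sparsity
  -- bounds |E(H)| by 2n, the process cannot go on forever.
  module Growth (twoTriangles : EdgesInTwoTriangles) (ℓ : ℕ) (1≤ℓ : 1 ≤ ℓ)
                (sparse : Sparse ℓ G) where

    sparse-bound : ∀ {H X} → Invariant H X → ℓ + nE H ≤ 2 * nV H
    sparse-bound {H} I = sparse H (invariant-edge I)

    -- f(H) ≥ 1 and f(H) ≤ 3 - |X| leave room for at most two surplus edges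
    surplus-≤2 : ∀ {H X} → Invariant H X → length X ≤ 2
    surplus-≤2 {H} {X} I =
      ≤-pred (+-cancelˡ-≤ (nE H) _ _ (subst (_≤ nE H + 3) (sym (+-suc (nE H) (length X))) bound))
      where
      bound : suc (nE H) + length X ≤ nE H + 3
      bound = ≤-trans (+-monoˡ-≤ (length X) (≤-trans (+-monoˡ-≤ (nE H) 1≤ℓ) (sparse-bound I)))
                      (Invariant.deficit I)

    edges-≤ : ∀ {H X} → Invariant H X → nE H ≤ 2 * n
    edges-≤ {H} I = ≤-trans (m≤n+m (nE H) ℓ) (≤-trans (sparse-bound I) (*-monoʳ-≤ 2 (count-≤ (vs H))))

    closed-impossible : ∀ {H X} → Invariant H X → Closed H → ⊥
    closed-impossible {H} {X} I closed with invariant-edge I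
    ... | i , j , _ with withinTwo-of-length X (surplus-≤2 I) (i , j)
    ... | γ , δ , within = Terminal.terminal twoTriangles H X closed within (Invariant.slots I)

    -- one step of the process uses one unit of fuel and adds at least one edge
    refuel : ∀ {e e′ k} → suc e ≤ e′ → 2 * n < e + suc k → 2 * n < e′ + k
    refuel {e} {e′} {k} e<e′ fuel = ≤-trans fuel (subst (_≤ e′ + k) (sym (+-suc e k)) (+-monoˡ-≤ k e<e′))

    -- with fuel k exceeding the room 2n - |E(H)| left for edges, growth is contradictory
    grow : ∀ k {H X} → Invariant H X → 2 * n < nE H + k → ⊥
    grow zero {H} I fuel = <⇒≱ fuel (subst (_≤ 2 * n) (sym (+-identityʳ (nE H))) (edges-≤ I))
    grow (suc k) {H} {X} I fuel with closed-or-unclosed H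
    ... | inj₁ closed = closed-impossible I closed
    ... | inj₂ (p , q , r , pq , pr , qr , pr∉H) with vs H r in r∈H?
    ... | true = grow k (EdgeStep.invariant⁺ pr (es-vsˡ H pq) r∈H? pr∉H I)
                        (refuel (≤-reflexive (sym (nE-addEdge H pr (es-vsˡ H pq) r∈H? pr∉H))) fuel)
    ... | false = grow k (attach-invariant pq pr qr r∈H? I)
                         (refuel (≤-trans (n≤1+n _) (≤-reflexive (sym (Attach.nE⁺ H pq pr qr r∈H?)))) fuel)

  commonNeighbour? : ∀ u v w → Dec (∃[ x ] (E G x u × E G x v × E G x w))
  commonNeighbour? u v w = any? λ x → (adj G x u ≟ᵇ true) ×-dec (adj G x v ≟ᵇ true) ×-dec (adj G x w ≟ᵇ true)

  emptySubgraph : Subgraph G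
  emptySubgraph = record { vs = λ _ → false ; es = λ _ _ → false ; es-sym = λ _ _ → refl
                         ; es-sub = λ _ _ () ; es-vs = λ _ _ () }

  VerticesIn : Subgraph G → List (Fin n) → Set
  VerticesIn H xs = ∀ {i} → vs H i ≡ true → i ∈ xs

  verticesIn-addVertex : ∀ H {xs} r → VerticesIn H xs → VerticesIn (addVertex H r) (r ∷ xs)
  verticesIn-addVertex H r within i∈H with addVertex-cases H r i∈H
  ... | inj₁ old = there (within old)
  ... | inj₂ refl = here refl

  outside-of : ∀ H {xs r} → VerticesIn H xs → All (λ t → ¬ r ≡ t) xs → vs H r ≡ false
  outside-of H within r∉xs = not-true λ r∈H → All¬⇒¬Any r∉xs (within r∈H)

  -- The
  -- hypothesis gives second triangles uvx, uwy, vwz, and x, y, z are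
  -- distinct (a coincidence would be a common neighbour).  The subgraph
  -- on u, v, w, x, y, z with its 9 edges has f = 3, no surplus edges, and the
  -- three separated tips x on uv, y on uw, z on vw.
  module Start (twoTriangles : EdgesInTwoTriangles) {u v w : Fin n} (uvw : Triangle G u v w)
               (noApex : ¬ (∃[ x ] (E G x u × E G x v × E G x w))) where

    uv : E G u v
    uv = proj₁ uvw
    vw : E G v w
    vw = proj₁ (proj₂ uvw)
    uw : E G u w
    uw = proj₂ (proj₂ uvw)

    apex-x : ∃[ x ] (¬ x ≡ w × Triangle G u v x)
    apex-x = twoTriangles u v w uvw
    apex-y : ∃[ y ] (¬ y ≡ v × Triangle G u w y)
    apex-y = twoTriangles u w v (uw , adj-sym vw , uv)
    apex-z : ∃[ z ] (¬ z ≡ u × Triangle G v w z)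
    apex-z = twoTriangles v w u (vw , adj-sym uw , adj-sym uv)

    x y z : Fin n
    x = proj₁ apex-x
    y = proj₁ apex-y
    z = proj₁ apex-z

    x≢w : ¬ x ≡ w
    x≢w = proj₁ (proj₂ apex-x)
    y≢v : ¬ y ≡ v
    y≢v = proj₁ (proj₂ apex-y)
    z≢u : ¬ z ≡ u
    z≢u = proj₁ (proj₂ apex-z)

    vx : E G v x
    vx = proj₁ (proj₂ (proj₂ (proj₂ apex-x)))
    ux : E G u x
    ux = proj₂ (proj₂ (proj₂ (proj₂ apex-x)))
    wy : E G w y
    wy = proj₁ (proj₂ (proj₂ (proj₂ apex-y)))
    uy : E G u y
    uy = proj₂ (proj₂ (proj₂ (proj₂ apex-y)))
    wz : E G w z
    wz = proj₁ (proj₂ (proj₂ (proj₂ apex-z)))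
    vz : E G v z
    vz = proj₂ (proj₂ (proj₂ (proj₂ apex-z)))

    -- two of x, y, z coinciding would be a common neighbour of u, v, w
    x≢y : ¬ x ≡ y
    x≢y x≡y = noApex (x , adj-sym ux , adj-sym vx , adj-sym (subst (E G w) (sym x≡y) wy))
    x≢z : ¬ x ≡ z
    x≢z x≡z = noApex (x , adj-sym ux , adj-sym vx , adj-sym (subst (E G w) (sym x≡z) wz))
    y≢z : ¬ y ≡ z
    y≢z y≡z = noApex (y , adj-sym uy , adj-sym (subst (E G v) (sym y≡z) vz) , adj-sym wy)

    u≢v : ¬ u ≡ v
    u≢v = adj-≢ uv
    v≢w : ¬ v ≡ w
    v≢w = adj-≢ vw
    u≢w : ¬ u ≡ w
    u≢w = adj-≢ uw
    x≢u : ¬ x ≡ u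
    x≢u = adj-≢ (adj-sym ux)
    x≢v : ¬ x ≡ v
    x≢v = adj-≢ (adj-sym vx)
    y≢u : ¬ y ≡ u
    y≢u = adj-≢ (adj-sym uy)
    y≢w : ¬ y ≡ w
    y≢w = adj-≢ (adj-sym wy)
    z≢v : ¬ z ≡ v
    z≢v = adj-≢ (adj-sym vz)
    z≢w : ¬ z ≡ w
    z≢w = adj-≢ (adj-sym wz)

    Hᵤ Hᵤᵥ : Subgraph G
    Hᵤ = addVertex emptySubgraph u
    Hᵤᵥ = addVertex Hᵤ v

    u∈Hᵤᵥ : vs Hᵤᵥ u ≡ true
    u∈Hᵤᵥ = addVertex-old Hᵤ v (addVertex-new emptySubgraph u)
    v∈Hᵤᵥ : vs Hᵤᵥ v ≡ true
    v∈Hᵤᵥ = addVertex-new Hᵤ v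

    H₂ : Subgraph G
    H₂ = addEdge Hᵤᵥ u v uv u∈Hᵤᵥ v∈Hᵤᵥ

    in₁ : VerticesIn Hᵤ (u ∷ [])
    in₁ = verticesIn-addVertex emptySubgraph u λ ()
    in₂ : VerticesIn H₂ (v ∷ u ∷ [])
    in₂ = verticesIn-addVertex Hᵤ v in₁

    nV₂ : nV H₂ ≡ 2
    nV₂ = trans (nV-addVertex Hᵤ v (outside-of Hᵤ in₁ ((u≢v ∘ sym) ∷ [])))
                (cong suc (trans (nV-addVertex emptySubgraph u refl) (cong suc (count-none {n}))))

    nE₂ : nE H₂ ≡ 1
    nE₂ = trans (nE-addEdge Hᵤᵥ uv u∈Hᵤᵥ v∈Hᵤᵥ refl) (cong suc (edgeCount-none {n}))

    uv∈H₂ : es H₂ u v ≡ true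
    uv∈H₂ = addEdge-new Hᵤᵥ uv u∈Hᵤᵥ v∈Hᵤᵥ

    w∉H₂ : vs H₂ w ≡ false
    w∉H₂ = outside-of H₂ in₂ ((v≢w ∘ sym) ∷ (u≢w ∘ sym) ∷ [])
    module AttachW = Attach H₂ uv∈H₂ uw vw w∉H₂
    H₃ : Subgraph G
    H₃ = AttachW.H⁺
    in₃ : VerticesIn H₃ (w ∷ v ∷ u ∷ [])
    in₃ = verticesIn-addVertex H₂ w in₂

    uv∈H₃ : es H₃ u v ≡ true
    uv∈H₃ = AttachW.es⁺-old {u} {v} uv∈H₂
    x∉H₃ : vs H₃ x ≡ false
    x∉H₃ = outside-of H₃ in₃ (x≢w ∷ x≢v ∷ x≢u ∷ [])
    module AttachX = Attach H₃ uv∈H₃ ux vx x∉H₃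
    module TipsX = AttachTips H₃ [] uv∈H₃ ux vx x∉H₃
    H₄ : Subgraph G
    H₄ = AttachX.H⁺
    in₄ : VerticesIn H₄ (x ∷ w ∷ v ∷ u ∷ [])
    in₄ = verticesIn-addVertex H₃ x in₃

    uw∈H₄ : es H₄ u w ≡ true
    uw∈H₄ = AttachX.es⁺-old {u} {w} AttachW.es⁺-pr
    y∉H₄ : vs H₄ y ≡ false
    y∉H₄ = outside-of H₄ in₄ ((x≢y ∘ sym) ∷ y≢w ∷ y≢v ∷ y≢u ∷ [])
    module AttachY = Attach H₄ uw∈H₄ uy wy y∉H₄
    module TipsY = AttachTips H₄ [] uw∈H₄ uy wy y∉H₄
    H₅ : Subgraph G
    H₅ = AttachY.H⁺
    in₅ : VerticesIn H₅ (y ∷ x ∷ w ∷ v ∷ u ∷ [])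
    in₅ = verticesIn-addVertex H₄ y in₄

    vw∈H₅ : es H₅ v w ≡ true
    vw∈H₅ = AttachY.es⁺-old {v} {w} (AttachX.es⁺-old {v} {w} AttachW.es⁺-qr)
    z∉H₅ : vs H₅ z ≡ false
    z∉H₅ = outside-of H₅ in₅ ((y≢z ∘ sym) ∷ (x≢z ∘ sym) ∷ z≢w ∷ z≢v ∷ z≢u ∷ [])
    module AttachZ = Attach H₅ vw∈H₅ vz wz z∉H₅
    module TipsZ = AttachTips H₅ [] vw∈H₅ vz wz z∉H₅

    H₆ : Subgraph G
    H₆ = AttachZ.H⁺

    nV₆ : nV H₆ ≡ 6
    nV₆ = trans AttachZ.nV⁺ (cong suc (trans AttachY.nV⁺ (cong suc (trans AttachX.nV⁺ (cong suc
            (trans AttachW.nV⁺ (cong suc nV₂)))))))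

    nE₆ : nE H₆ ≡ 9
    nE₆ = trans AttachZ.nE⁺ (cong (2 +_) (trans AttachY.nE⁺ (cong (2 +_) (trans AttachX.nE⁺ (cong (2 +_)
            (trans AttachW.nE⁺ (cong (2 +_) nE₂)))))))

    -- the three tips: each new vertex has only its two attachment neighbours
    tip-x : SlotOK H₆ [] (tip x u v)
    tip-x = TipsZ.keeps-tip (x≢v , x≢w) (TipsY.keeps-tip (x≢u , x≢w) TipsX.new-tip)

    tip-y : SlotOK H₆ [] (tip y u w)
    tip-y = TipsZ.keeps-tip (y≢v , y≢w) TipsY.new-tip

    tip-z : SlotOK H₆ [] (tip z v w)
    tip-z = TipsZ.new-tip

    start : Invariant H₆ []
    start = record
      { deficit = subst₂ _≤_ (cong (λ k → 2 * k + 0) (sym nV₆)) (cong (_+ 3) (sym nE₆)) ≤-refl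
      ; surplus⊆H = λ ()
      ; slots = record
          { s₁ = tip x u v ; s₂ = tip y u w ; s₃ = tip z v w
          ; ok₁ = tip-x ; ok₂ = tip-y ; ok₃ = tip-z
          ; sep₁₂ = x≢y , (x≢u , x≢w) , (y≢u , y≢v) ,
                    λ { (inj₁ (_ , v≡w)) → v≢w v≡w ; (inj₂ (u≡w , _)) → u≢w u≡w }
          ; sep₁₃ = x≢z , (x≢v , x≢w) , (z≢u , z≢v) ,
                    λ { (inj₁ (u≡v , _)) → u≢v u≡v ; (inj₂ (u≡w , _)) → u≢w u≡w }
          ; sep₂₃ = y≢z , (y≢v , y≢w) , (z≢u , z≢w) ,
                    λ { (inj₁ (u≡v , _)) → u≢v u≡v ; (inj₂ (u≡w , _)) → u≢w u≡w } } }

-- ℓ ∈ {1, 2} is used only through ℓ ≥ 1.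
ℓ≥1 : ∀ {ℓ} → ℓ ≡ 1 ⊎ ℓ ≡ 2 → 1 ≤ ℓ
ℓ≥1 (inj₁ refl) = s≤s z≤n
ℓ≥1 (inj₂ refl) = s≤s z≤n

-- If the triangle uvw had no common neighbour, the growth process started
-- from 'Start' would run for more than 2n steps, which sparsity forbids.
lemma3p9 : (ℓ : ℕ) → (ℓ ≡ 1 ⊎ ℓ ≡ 2) → (n : ℕ) → (G : Graph n) → Tight ℓ G →
    (∀ u v w → Triangle G u v w → ∃[ w′ ] (¬ w′ ≡ w × Triangle G u v w′)) →
    ∀ u v w → Triangle G u v w → ∃[ x ] (E G x u × E G x v × E G x w)
lemma3p9 ℓ ℓ∈12 n G (sparse , _) twoTriangles u v w uvw with commonNeighbour? G u v w
... | yes apex = apex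
... | no noApex = ⊥-elim (grow (suc (2 * n)) start (m≤n+m (suc (2 * n)) (nE H₆)))
  where
  open Growth G twoTriangles ℓ (ℓ≥1 ℓ∈12) sparse
  open Start G twoTriangles uvw noApex
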